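{- Let $G$ be a biconnected graph that has no single cutsets. Then either $G$ is triconnected or $G$ is a simple cycle.
   Context: All graphs are finite, undirected, without loops or multiple edges. A connected component means the vertex set of a maximal connected subgraph. A set $R\subset V(G)$ is a cutset if $G-R$ (delete the vertices of $R$) is disconnected; $\mathfrak R_2(G)$ is the set of 2-vertex cutsets. $R$ splits $X\subset V(G)$ if $X\setminus R$ is not contained in one connected component of $G-R$. $G$ is $k$-connected if $v(G)>k$ and $G$ has no cutset with at most $k-1$ vertices; biconnected means 2-connected, triconnected means 3-connected. Cutsets $S,T\in\mathfrak R_2(G)$ are independent if neither splits the other; $S\in\mathfrak R_2(G)$ is single if it is independent with all other cutsets of $\mathfrak R_2(G)$. -}

module Defs where

open import Data.Nat using (ℕ; zero; suc; _≤_; _<_)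
open import Data.Fin using (Fin; toℕ)
open import Data.Fin.Subset using (Subset; _∈_; _∉_; ∁; ∣_∣)
open import Data.Fin.Permutation using (Permutation′; _⟨$⟩ʳ_)
open import Data.Product using (Σ; ∃; _×_; _,_)
open import Data.Sum using (_⊎_)
open import Relation.Nullary using (¬_)
open import Relation.Binary.PropositionalEquality using (_≡_; _≢_)
open import Relation.Binary.Definitions using (Decidable)
open import Function.Bundles using (_⇔_)

record Graph (n : ℕ) : Set₁ where
  field
    Adj    : Fin n → Fin n → Set
    adj?   : Decidable Adj
    sym    : ∀ {u v} → Adj u v → Adj v u
    irrefl : ∀ {v} → ¬ Adj v v
open Graph public

module _ {n : ℕ} (G : Graph n) where

  -- Walks in G all of whose vertices lie in the vertex set X
  -- (i.e. walks in the induced subgraph G[X]).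
  data WalkIn (X : Subset n) : Fin n → Fin n → Set where
    here : ∀ {v} → v ∈ X → WalkIn X v v
    step : ∀ {u w v} → u ∈ X → Adj G u w → WalkIn X w v → WalkIn X u v

  Connected-in-minus : Subset n → Fin n → Fin n → Set
  Connected-in-minus R u v = WalkIn (∁ R) u v

  Splits : Subset n → Subset n → Set
  Splits R X = Σ (Fin n) λ u → Σ (Fin n) λ v →
    u ∈ X × v ∈ X × u ∉ R × v ∉ R × ¬ Connected-in-minus R u v

  Cutset : Subset n → Set
  Cutset R = Σ (Fin n) λ u → Σ (Fin n) λ v →
    u ∉ R × v ∉ R × ¬ Connected-in-minus R u v

  Cutset₂ : Subset n → Set
  Cutset₂ R = ∣ R ∣ ≡ 2 × Cutset R

  KConnected : ℕ → Set
  KConnected k = k < n × (∀ (R : Subset n) → suc ∣ R ∣ ≤ k → ¬ Cutset R)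

  Biconnected : Set
  Biconnected = KConnected 2

  Triconnected : Set
  Triconnected = KConnected 3

  Independent : Subset n → Subset n → Set
  Independent S T = ¬ Splits S T × ¬ Splits T S

  Single : Subset n → Set
  Single S = Cutset₂ S × (∀ T → Cutset₂ T → T ≢ S → Independent S T)

  CycleAdj : Fin n → Fin n → Set
  CycleAdj i j =
    toℕ j ≡ suc (toℕ i) ⊎ toℕ i ≡ suc (toℕ j)
    ⊎ (toℕ i ≡ 0 × suc (toℕ j) ≡ n) ⊎ (toℕ j ≡ 0 × suc (toℕ i) ≡ n)

  IsCycle : Set
  IsCycle = 3 ≤ n × Σ (Permutation′ n) λ π →
    ∀ i j → Adj G (π ⟨$⟩ʳ i) (π ⟨$⟩ʳ j) ⇔ CycleAdj i j

module Submission where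

-- Without 2-cutsets G is triconnected, or it is the triangle when n = 3.
-- Given a 2-cutset {a, b}, call a set W of vertices a *fragment* at {a, b}
-- if it avoids a and b, is closed under neighbours in G - {a, b} and misses
-- some vertex.  The main lemma (traverse) says every fragment is listed,
-- without repetitions, by a chain a, w₁, …, wₖ, b in which each wᵢ has
-- exactly its two sequence neighbours as neighbours.  By induction on |W|:
-- {a, b} is a 2-cutset that is not single, which in a biconnected graph
-- yields a 2-cutset T separating a from b (splits-back); T meets W in a
-- single vertex c (split), and W - c falls into the parts joined to a and to
-- b in G - T (Near, Halves) -- two smaller fragments whose chains splice at c.
-- A component of G - {a, b} and its complementary fragment then close up
-- into a chain through all vertices (Hamiltonian), and such a cyclic chain
-- is a cycle (cyclic-chain⇒cycle).  Components are computed by a bounded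
-- search, which makes connectivity, and hence every case split, decidable.

open import Defs renaming (sym to edge-sym)
open import Data.Nat using (ℕ; zero; suc; _+_; _≤_; _<_; z≤n; s≤s)
import Data.Nat as ℕ
import Data.Nat.Properties as ℕₚ
open import Data.Bool.Properties using () renaming (_≟_ to _≟ᵇ_)
open import Data.Fin using (Fin; zero; suc; toℕ)
open import Data.Fin.Properties using (_≟_; any?; toℕ<n; toℕ-injective)
open import Data.Fin.Subset
  using (Subset; _∈_; _∉_; _⊆_; ∁; ∣_∣; ⁅_⁆; _∪_; _∩_; ⊤; inside; outside)
open import Data.Fin.Subset.Properties
  using (_∈?_; x∈p∩q⁺; x∈p∩q⁻; p∩q⊆q; x∈p∪q⁺; x∈p∪q⁻; x∈⁅x⁆; x∈⁅y⁆⇒x≡y; ∈⊤;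
         x∈∁p⇒x∉p; x∉p⇒x∈∁p; p⊂q⇒∣p∣<∣q∣; p⊆q⇒∣p∣≤∣q∣; ∣p∣≡n⇒p≡⊤; ∣p∣≤n;
         ∪-identityʳ; ∪-comm; ∣⁅x⁆∣≡1; ∣⊥∣≡0; ∣⊤∣≡n; Empty-unique; ⊆-antisym;
         anySubset?)
open import Data.Vec.Base using (_∷_; here; there)
open import Data.List using (List; []; _∷_; _++_; length; lookup)
open import Data.List.Relation.Unary.Any using (here; there)
import Data.List.Relation.Unary.Any as Any
open import Data.List.Relation.Unary.Any.Properties using (lookup-index)
open import Data.List.Relation.Unary.All using ([]; _∷_)
open import Data.List.Relation.Unary.All.Properties using (¬Any⇒All¬)
open import Data.List.Membership.Propositional using () renaming (_∈_ to _∈ₗ_; _∉_ to _∉ₗ_)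
open import Data.List.Membership.Propositional.Properties using (∈-++⁺ˡ; ∈-++⁺ʳ; ∈-++⁻; ∈-lookup)
open import Data.List.Relation.Unary.Unique.Propositional using (Unique; []; _∷_)
import Data.List.Relation.Unary.Unique.Propositional.Properties as Unique
open import Data.Vec.Properties using (≡-dec)
open import Data.Product using (Σ; ∃; _×_; _,_; proj₁; proj₂)
open import Data.Sum using (_⊎_; inj₁; inj₂; [_,_])
open import Data.Empty using (⊥; ⊥-elim)
open import Function using (_∘_)
open import Function.Bundles using (_⇔_; mk⇔; mk↔ₛ′)
open import Function.Construct.Composition using (_⇔-∘_)
open import Data.Fin.Permutation using (Permutation; _⟨$⟩ʳ_; ↔⇒≡)
open import Relation.Nullary using (¬_; Dec; yes; no; contradiction)
open import Relation.Nullary.Decidable using (_×-dec_; ¬?)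
open import Relation.Binary.PropositionalEquality
  using (_≡_; _≢_; refl; sym; trans; cong; subst)

∣p∪⁅x⁆∣≡1+∣p∣ : ∀ {n} (p : Subset n) (x : Fin n) → x ∉ p → ∣ p ∪ ⁅ x ⁆ ∣ ≡ suc ∣ p ∣
∣p∪⁅x⁆∣≡1+∣p∣ (outside ∷ p) zero    _   = cong suc (cong ∣_∣ (∪-identityʳ p))
∣p∪⁅x⁆∣≡1+∣p∣ (inside  ∷ p) zero    x∉p = ⊥-elim (x∉p here)
∣p∪⁅x⁆∣≡1+∣p∣ (outside ∷ p) (suc x) x∉p = ∣p∪⁅x⁆∣≡1+∣p∣ p x (λ h → x∉p (there h))
∣p∪⁅x⁆∣≡1+∣p∣ (inside  ∷ p) (suc x) x∉p = cong suc (∣p∪⁅x⁆∣≡1+∣p∣ p x (λ h → x∉p (there h)))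

⊆-by-size : ∀ {n} {p q : Subset n} → q ⊆ p → ∣ p ∣ ≤ ∣ q ∣ → p ⊆ q
⊆-by-size {q = q} q⊆p ∣p∣≤∣q∣ {x} x∈p with x ∈? q
... | yes x∈q = x∈q
... | no  x∉q = contradiction ∣p∣≤∣q∣ (ℕₚ.<⇒≱ (p⊂q⇒∣p∣<∣q∣ (q⊆p , x , x∈p , x∉q)))

∈∁∪ : ∀ {n} {p q : Subset n} {x} → x ∉ p → x ∉ q → x ∈ ∁ (p ∪ q)
∈∁∪ {p = p} {q} x∉p x∉q = x∉p⇒x∈∁p λ x∈ → [ x∉p , x∉q ] (x∈p∪q⁻ p q x∈)

pair : ∀ {n} → Fin n → Fin n → Subset n
pair a b = ⁅ a ⁆ ∪ ⁅ b ⁆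

module _ {n : ℕ} {a b : Fin n} where

  a∈pair : a ∈ pair a b
  a∈pair = x∈p∪q⁺ (inj₁ (x∈⁅x⁆ a))

  b∈pair : b ∈ pair a b
  b∈pair = x∈p∪q⁺ (inj₂ (x∈⁅x⁆ b))

  ∈-pair⁻ : ∀ {y} → y ∈ pair a b → y ≡ a ⊎ y ≡ b
  ∈-pair⁻ y∈ with x∈p∪q⁻ ⁅ a ⁆ ⁅ b ⁆ y∈
  ... | inj₁ y∈a = inj₁ (x∈⁅y⁆⇒x≡y a y∈a)
  ... | inj₂ y∈b = inj₂ (x∈⁅y⁆⇒x≡y b y∈b)

  ∉-pair : ∀ {y} → y ≢ a → y ≢ b → y ∉ pair a b
  ∉-pair y≢a y≢b y∈ = [ y≢a , y≢b ] (∈-pair⁻ y∈)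

  pair-comm : pair a b ≡ pair b a
  pair-comm = ∪-comm ⁅ a ⁆ ⁅ b ⁆

  ∣pair∣≡2 : a ≢ b → ∣ pair a b ∣ ≡ 2
  ∣pair∣≡2 a≢b = trans (∣p∪⁅x⁆∣≡1+∣p∣ ⁅ a ⁆ b (a≢b ∘ sym ∘ x∈⁅y⁆⇒x≡y a)) (cong suc (∣⁅x⁆∣≡1 a))

  pair-⊆ : ∀ {R : Subset n} → a ∈ R → b ∈ R → pair a b ⊆ R
  pair-⊆ a∈R b∈R y∈ with ∈-pair⁻ y∈
  ... | inj₁ refl = a∈R
  ... | inj₂ refl = b∈R

  ⊆-pair : ∀ {R : Subset n} → a ≢ b → a ∈ R → b ∈ R → ∣ R ∣ ≤ 2 → R ⊆ pair a b
  ⊆-pair {R} a≢b a∈R b∈R ∣R∣≤2 =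
    ⊆-by-size (pair-⊆ a∈R b∈R) (subst (∣ R ∣ ≤_) (sym (∣pair∣≡2 a≢b)) ∣R∣≤2)

two-element : ∀ {n} (R : Subset n) → ∣ R ∣ ≡ 2 →
  Σ (Fin n) λ a → Σ (Fin n) λ b → a ≢ b × R ≡ pair a b
two-element {n} R ∣R∣≡2 with any? (_∈? R)
... | no empty =
  contradiction (trans (sym ∣R∣≡2) (trans (cong ∣_∣ (Empty-unique empty)) (∣⊥∣≡0 n))) λ ()
... | yes (a , a∈R) with any? (λ b → (b ∈? R) ×-dec ¬? (b ≟ a))
...   | yes (b , b∈R , b≢a) = a , b , a≢b ,
        ⊆-antisym (⊆-pair a≢b a∈R b∈R (ℕₚ.≤-reflexive ∣R∣≡2)) (pair-⊆ a∈R b∈R)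
  where
  a≢b : a ≢ b
  a≢b = b≢a ∘ sym
...   | no only-a = contradiction (subst (_≤ 1) ∣R∣≡2 ∣R∣≤1) λ { (s≤s ()) }
  where
  R⊆a : R ⊆ ⁅ a ⁆
  R⊆a {y} y∈R with y ≟ a
  ... | yes refl = x∈⁅x⁆ a
  ... | no  y≢a  = ⊥-elim (only-a (y , y∈R , y≢a))
  ∣R∣≤1 : ∣ R ∣ ≤ 1
  ∣R∣≤1 = subst (∣ R ∣ ≤_) (∣⁅x⁆∣≡1 a) (p⊆q⇒∣p∣≤∣q∣ R⊆a)

module _ {A : Set} where

  -- In the sequence  p, xs, q  the vertex after p is  headOr xs q  and
  -- the vertex before q is  lastOr p xs.
  headOr : List A → A → A
  headOr []      q = q
  headOr (x ∷ _) _ = x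

  lastOr : A → List A → A
  lastOr p []       = p
  lastOr _ (x ∷ xs) = lastOr x xs

  headOr-++ : ∀ xs {c ys q} → headOr (xs ++ c ∷ ys) q ≡ headOr xs c
  headOr-++ []      = refl
  headOr-++ (_ ∷ _) = refl

  lookup-injective : ∀ {L : List A} → Unique L → ∀ i j → lookup L i ≡ lookup L j → i ≡ j
  lookup-injective {_ ∷ _} _ zero zero _ = refl
  lookup-injective {_ ∷ xs} u zero (suc j) eq =
    ⊥-elim (Unique.Unique[x∷xs]⇒x∉xs u (subst (_∈ₗ xs) (sym eq) (∈-lookup j)))
  lookup-injective {_ ∷ xs} u (suc i) zero eq =
    ⊥-elim (Unique.Unique[x∷xs]⇒x∉xs u (subst (_∈ₗ xs) eq (∈-lookup i)))
  lookup-injective {_ ∷ _} (_ ∷ u) (suc i) (suc j) eq = cong suc (lookup-injective u i j eq)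

  ∉[] : ∀ {y : A} → y ∉ₗ []
  ∉[] ()

  unique-splice : ∀ {xs ys : List A} {c : A} → Unique xs → Unique ys → c ∉ₗ xs → c ∉ₗ ys →
    (∀ {y} → y ∈ₗ xs → y ∈ₗ ys → ⊥) → Unique (xs ++ c ∷ ys)
  unique-splice {xs} {ys} {c} xs-unique ys-unique c∉xs c∉ys disjoint =
    Unique.++⁺ xs-unique (¬Any⇒All¬ ys c∉ys ∷ ys-unique) separate
    where
    separate : ∀ {y} → ¬ (y ∈ₗ xs × y ∈ₗ c ∷ ys)
    separate (y∈xs , here refl)  = c∉xs y∈xs
    separate (y∈xs , there y∈ys) = disjoint y∈xs y∈ys

Succ : ∀ {m} → Fin m → Fin m → Set
Succ {m} i j = toℕ j ≡ suc (toℕ i) ⊎ (toℕ j ≡ 0 × suc (toℕ i) ≡ m)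

succ-functional : ∀ {m} {i j k : Fin m} → Succ i j → Succ i k → j ≡ k
succ-functional (inj₁ j≡i+1)     (inj₁ k≡i+1)     = toℕ-injective (trans j≡i+1 (sym k≡i+1))
succ-functional (inj₂ (j≡0 , _)) (inj₂ (k≡0 , _)) = toℕ-injective (trans j≡0 (sym k≡0))
succ-functional {j = j} (inj₁ j≡i+1) (inj₂ (_ , i+1≡m)) =
  ⊥-elim (ℕₚ.<-irrefl (trans j≡i+1 i+1≡m) (toℕ<n j))
succ-functional {k = k} (inj₂ (_ , i+1≡m)) (inj₁ k≡i+1) =
  ⊥-elim (ℕₚ.<-irrefl (trans k≡i+1 i+1≡m) (toℕ<n k))

succ-injective : ∀ {m} {i j k : Fin m} → Succ i k → Succ j k → i ≡ j
succ-injective (inj₁ k≡i+1)       (inj₁ k≡j+1)       =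
  toℕ-injective (ℕₚ.suc-injective (trans (sym k≡i+1) k≡j+1))
succ-injective (inj₂ (_ , i+1≡m)) (inj₂ (_ , j+1≡m)) =
  toℕ-injective (ℕₚ.suc-injective (trans i+1≡m (sym j+1≡m)))
succ-injective (inj₁ k≡i+1)       (inj₂ (k≡0 , _))   = ⊥-elim (ℕₚ.0≢1+n (trans (sym k≡0) k≡i+1))
succ-injective (inj₂ (k≡0 , _))   (inj₁ k≡j+1)       = ⊥-elim (ℕₚ.0≢1+n (trans (sym k≡0) k≡j+1))

module _ {n : ℕ} (G : Graph n) where

  start∈ : ∀ {X u v} → WalkIn G X u v → u ∈ X
  start∈ (here u∈X)     = u∈X
  start∈ (step u∈X _ _) = u∈X

  end∈ : ∀ {X u v} → WalkIn G X u v → v ∈ X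
  end∈ (here v∈X)   = v∈X
  end∈ (step _ _ w) = end∈ w

  infixr 5 _++ʷ_
  _++ʷ_ : ∀ {X u v w} → WalkIn G X u v → WalkIn G X v w → WalkIn G X u w
  here _       ++ʷ q = q
  step u∈X e p ++ʷ q = step u∈X e (p ++ʷ q)

  edgeʷ : ∀ {X u v} → u ∈ X → Adj G u v → v ∈ X → WalkIn G X u v
  edgeʷ u∈X e v∈X = step u∈X e (here v∈X)

  snocʷ : ∀ {X u v w} → WalkIn G X u v → Adj G v w → w ∈ X → WalkIn G X u w
  snocʷ p e w∈X = p ++ʷ edgeʷ (end∈ p) e w∈X

  reverseʷ : ∀ {X u v} → WalkIn G X u v → WalkIn G X v u
  reverseʷ (here v∈X)     = here v∈X
  reverseʷ (step u∈X e p) = snocʷ (reverseʷ p) (edge-sym G e) u∈X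

  widen : ∀ {X Y u v} → X ⊆ Y → WalkIn G X u v → WalkIn G Y u v
  widen X⊆Y (here v∈X)     = here (X⊆Y v∈X)
  widen X⊆Y (step u∈X e p) = step (X⊆Y u∈X) e (widen X⊆Y p)

  Closed : Subset n → Subset n → Set
  Closed X C = ∀ {w w'} → w ∈ C → w' ∈ X → Adj G w w' → w' ∈ C

  closed-walk : ∀ {X C u v} → Closed X C → u ∈ C → WalkIn G X u v → v ∈ C
  closed-walk C-closed u∈C (here _)     = u∈C
  closed-walk C-closed u∈C (step _ e p) = closed-walk C-closed (C-closed u∈C (start∈ p) e) p

  closed-∪ : ∀ {X C D} → Closed X C → Closed X D → Closed X (C ∪ D)
  closed-∪ {C = C} {D} C-closed D-closed w∈ w'∈X e with x∈p∪q⁻ C D w∈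
  ... | inj₁ w∈C = x∈p∪q⁺ (inj₁ (C-closed w∈C w'∈X e))
  ... | inj₂ w∈D = x∈p∪q⁺ (inj₂ (D-closed w∈D w'∈X e))

  record Exit (X K : Subset n) (u : Fin n) : Set where
    field
      last-inside first-outside : Fin n
      outside-K  : first-outside ∉ K
      outside-∈X : first-outside ∈ X
      crossing   : Adj G last-inside first-outside
      route      : WalkIn G (X ∩ K) u last-inside

  exit : ∀ {X K u v} → u ∈ K → v ∉ K → WalkIn G X u v → Exit X K u
  exit u∈K v∉K (here _) = ⊥-elim (v∉K u∈K)
  exit {K = K} u∈K v∉K (step {w = w} u∈X e p) with w ∈? K
  ... | no  w∉K = record
    { outside-K = w∉K ; outside-∈X = start∈ p ; crossing = e
    ; route = here (x∈p∩q⁺ (u∈X , u∈K)) }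
  ... | yes w∈K = record
    { outside-K = outside-K ; outside-∈X = outside-∈X ; crossing = crossing
    ; route = step (x∈p∩q⁺ (u∈X , u∈K)) e route }
    where open Exit (exit w∈K v∉K p)

  record Component (X : Subset n) (s : Fin n) : Set where
    field
      members   : Subset n
      source    : s ∈ members
      reachable : ∀ {w} → w ∈ members → WalkIn G X s w
      closed    : Closed X members
  open Component public

  Frontier : Subset n → Subset n → Set
  Frontier X C = ∃ λ w → ∃ λ w' → w ∈ C × w' ∈ X × w' ∉ C × Adj G w w'

  frontier? : ∀ X C → Dec (Frontier X C)
  frontier? X C = any? λ w → any? λ w' →
    (w ∈? C) ×-dec (w' ∈? X) ×-dec ¬? (w' ∈? C) ×-dec adj? G w w'

  -- Grow a set C of vertices reachable from s by one frontier vertex at a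
  -- time; the fuel k, with n ≤ k + |C|, bounds the number of steps, and
  -- when it runs out C already contains every vertex.
  grow : ∀ X s (k : ℕ) (C : Subset n) → s ∈ C →
         (∀ {w} → w ∈ C → WalkIn G X s w) → n ≤ k + ∣ C ∣ → Component X s
  grow X s zero C s∈C reach n≤∣C∣ = record
    { members = C ; source = s∈C ; reachable = reach
    ; closed = λ {_} {w'} _ _ _ → subst (w' ∈_) (sym C≡⊤) ∈⊤ }
    where C≡⊤ = ∣p∣≡n⇒p≡⊤ (ℕₚ.≤-antisym (∣p∣≤n C) n≤∣C∣)
  grow X s (suc k) C s∈C reach bound with frontier? X C
  ... | no no-frontier = record
    { members = C ; source = s∈C ; reachable = reach ; closed = C-closed }
    where
    C-closed : Closed X C
    C-closed {w} {w'} w∈C w'∈X e with w' ∈? C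
    ... | yes w'∈C = w'∈C
    ... | no  w'∉C = ⊥-elim (no-frontier (w , w' , w∈C , w'∈X , w'∉C , e))
  ... | yes (w , w' , w∈C , w'∈X , w'∉C , e) =
    grow X s k (C ∪ ⁅ w' ⁆) (x∈p∪q⁺ (inj₁ s∈C)) reach' bound'
    where
    reach' : ∀ {x} → x ∈ C ∪ ⁅ w' ⁆ → WalkIn G X s x
    reach' x∈ with x∈p∪q⁻ C ⁅ w' ⁆ x∈
    ... | inj₁ x∈C  = reach x∈C
    ... | inj₂ x∈w' = subst (WalkIn G X s) (sym (x∈⁅y⁆⇒x≡y w' x∈w')) (snocʷ (reach w∈C) e w'∈X)
    bound' : n ≤ k + ∣ C ∪ ⁅ w' ⁆ ∣
    bound' = ℕₚ.≤-trans bound (ℕₚ.≤-reflexive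
      (trans (sym (ℕₚ.+-suc k ∣ C ∣)) (cong (k +_) (sym (∣p∪⁅x⁆∣≡1+∣p∣ C w' w'∉C)))))

  component : ∀ X s → s ∈ X → Component X s
  component X s s∈X = grow X s n ⁅ s ⁆ (x∈⁅x⁆ s) reach (ℕₚ.m≤m+n n _)
    where
    reach : ∀ {w} → w ∈ ⁅ s ⁆ → WalkIn G X s w
    reach w∈s = subst (WalkIn G X s) (sym (x∈⁅y⁆⇒x≡y s w∈s)) (here s∈X)

  connected? : ∀ X u v → Dec (WalkIn G X u v)
  connected? X u v with u ∈? X
  ... | no  u∉X = no (u∉X ∘ start∈)
  ... | yes u∈X with v ∈? members (component X u u∈X)
  ...   | yes v∈C = yes (reachable (component X u u∈X) v∈C)
  ...   | no  v∉C = no (v∉C ∘ closed-walk (closed C) (source C))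
    where C = component X u u∈X

  cutset? : ∀ R → Dec (Cutset G R)
  cutset? R = any? λ u → any? λ v →
    ¬? (u ∈? R) ×-dec ¬? (v ∈? R) ×-dec ¬? (connected? (∁ R) u v)

  cutset₂? : ∀ R → Dec (Cutset₂ G R)
  cutset₂? R = (∣ R ∣ ℕ.≟ 2) ×-dec cutset? R

  splits? : ∀ R X → Dec (Splits G R X)
  splits? R X = any? λ u → any? λ v → (u ∈? X) ×-dec (v ∈? X) ×-dec
    ¬? (u ∈? R) ×-dec ¬? (v ∈? R) ×-dec ¬? (connected? (∁ R) u v)

  independent? : ∀ S T → Dec (Independent G S T)
  independent? S T = ¬? (splits? S T) ×-dec ¬? (splits? T S)

  crossing-cutset : ∀ {S} → Cutset₂ G S → ¬ Single G S →
    Σ (Subset n) λ T → Cutset₂ G T × (Splits G S T ⊎ Splits G T S)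
  crossing-cutset {S} S-cut not-single
    with anySubset? (λ T → cutset₂? T ×-dec ¬? (≡-dec _≟ᵇ_ T S) ×-dec ¬? (independent? S T))
  ... | no none = ⊥-elim (not-single (S-cut , independent))
    where
    independent : ∀ T → Cutset₂ G T → T ≢ S → Independent G S T
    independent T T-cut T≢S with splits? S T | splits? T S
    ... | no S∤T | no T∤S = S∤T , T∤S
    ... | yes S|T | _     = ⊥-elim (none (T , T-cut , T≢S , λ i → proj₁ i S|T))
    ... | no _    | yes T|S = ⊥-elim (none (T , T-cut , T≢S , λ i → proj₂ i T|S))
  ... | yes (T , T-cut , _ , dependent) with splits? S T | splits? T S
  ...   | yes S|T | _       = T , T-cut , inj₁ S|T
  ...   | no _    | yes T|S = T , T-cut , inj₂ T|S
  ...   | no S∤T  | no T∤S  = ⊥-elim (dependent (S∤T , T∤S))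

  Separates : Subset n → Fin n → Fin n → Set
  Separates R a b = a ∉ R × b ∉ R × ¬ WalkIn G (∁ R) a b

  separates-sym : ∀ {R a b} → Separates R a b → Separates R b a
  separates-sym (a∉R , b∉R , ¬a~b) = b∉R , a∉R , ¬a~b ∘ reverseʷ

  splits-pair : ∀ {R a b} → Splits G R (pair a b) → Separates R a b
  splits-pair (u , v , u∈ , v∈ , u∉R , v∉R , ¬u~v) with ∈-pair⁻ u∈ | ∈-pair⁻ v∈
  ... | inj₁ refl | inj₂ refl = u∉R , v∉R , ¬u~v
  ... | inj₂ refl | inj₁ refl = v∉R , u∉R , ¬u~v ∘ reverseʷ
  ... | inj₁ refl | inj₁ refl = ⊥-elim (¬u~v (here (x∉p⇒x∈∁p u∉R)))
  ... | inj₂ refl | inj₂ refl = ⊥-elim (¬u~v (here (x∉p⇒x∈∁p u∉R)))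

  record Fragment (a b : Fin n) (W : Subset n) : Set where
    field
      a≢b      : a ≢ b
      a∉W      : a ∉ W
      b∉W      : b ∉ W
      W-closed : Closed (∁ (pair a b)) W
      outer    : Fin n
      outer∉W  : outer ∉ W
      outer∉ab : outer ∉ pair a b

    neighbour : ∀ {w y} → w ∈ W → Adj G w y → y ∈ W ⊎ y ≡ a ⊎ y ≡ b
    neighbour {y = y} w∈W e with y ∈? pair a b
    ... | yes y∈ab = inj₂ (∈-pair⁻ y∈ab)
    ... | no  y∉ab = inj₁ (W-closed w∈W (x∉p⇒x∈∁p y∉ab) e)

    ∈W⇒∉ab : ∀ {w} → w ∈ W → w ∉ pair a b
    ∈W⇒∉ab w∈W = ∉-pair (λ { refl → a∉W w∈W }) (λ { refl → b∉W w∈W })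

  fragment-swap : ∀ {a b W} → Fragment a b W → Fragment b a W
  fragment-swap {W = W} F = record
    { a≢b = a≢b ∘ sym ; a∉W = b∉W ; b∉W = a∉W
    ; W-closed = subst (λ P → Closed (∁ P) W) pair-comm W-closed
    ; outer = outer ; outer∉W = outer∉W ; outer∉ab = subst (outer ∉_) pair-comm outer∉ab }
    where open Fragment F

  fragment-cutset : ∀ {a b W w} → Fragment a b W → w ∈ W → Cutset₂ G (pair a b)
  fragment-cutset F w∈W = ∣pair∣≡2 a≢b ,
    (_ , outer , ∈W⇒∉ab w∈W , outer∉ab , λ w~outer → outer∉W (closed-walk W-closed w∈W w~outer))
    where open Fragment F

  complement : ∀ {a b W w} → Fragment a b W → w ∈ W → Fragment b a (∁ (W ∪ pair a b))
  complement {a} {b} {W} F w∈W = record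
    { a≢b = a≢b ∘ sym
    ; a∉W = λ b∈Z → x∈∁p⇒x∉p b∈Z (x∈p∪q⁺ (inj₂ b∈pair))
    ; b∉W = λ a∈Z → x∈∁p⇒x∉p a∈Z (x∈p∪q⁺ (inj₂ a∈pair))
    ; W-closed = Z-closed
    ; outer = _ ; outer∉W = λ w∈Z → x∈∁p⇒x∉p w∈Z (x∈p∪q⁺ (inj₁ w∈W))
    ; outer∉ab = subst (_ ∉_) pair-comm (∈W⇒∉ab w∈W) }
    where
    open Fragment F
    Z-closed : Closed (∁ (pair b a)) (∁ (W ∪ pair a b))
    Z-closed {z} {y} z∈Z y∉ba e = ∈∁∪ y∉W (subst (y ∉_) (sym pair-comm) (x∈∁p⇒x∉p y∉ba))
      where
      y∉W : y ∉ W
      y∉W y∈W = x∈∁p⇒x∉p z∈Z (x∈p∪q⁺ (back (neighbour y∈W (edge-sym G e))))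
        where
        back : z ∈ W ⊎ z ≡ a ⊎ z ≡ b → z ∈ W ⊎ z ∈ pair a b
        back (inj₁ z∈W)         = inj₁ z∈W
        back (inj₂ (inj₁ refl)) = inj₂ a∈pair
        back (inj₂ (inj₂ refl)) = inj₂ b∈pair

  component-fragment : ∀ {a b s z} → a ≢ b → (s∉ab : s ∉ pair a b) → z ∉ pair a b →
    ¬ WalkIn G (∁ (pair a b)) s z →
    Fragment a b (members (component (∁ (pair a b)) s (x∉p⇒x∈∁p s∉ab)))
  component-fragment {a} {b} {s} {z} a≢b s∉ab z∉ab ¬s~z = record
    { a≢b = a≢b
    ; a∉W = λ a∈K → x∈∁p⇒x∉p (end∈ (reachable K a∈K)) a∈pair
    ; b∉W = λ b∈K → x∈∁p⇒x∉p (end∈ (reachable K b∈K)) b∈pair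
    ; W-closed = closed K
    ; outer = z ; outer∉W = ¬s~z ∘ reachable K ; outer∉ab = z∉ab }
    where K = component (∁ (pair a b)) s (x∉p⇒x∈∁p s∉ab)

  record Between (x p q : Fin n) : Set where
    field
      only  : ∀ {y} → Adj G x y → y ≡ p ⊎ y ≡ q
      adj-p : Adj G x p
      adj-q : Adj G x q

  data Chain : Fin n → List (Fin n) → Fin n → Set where
    []  : ∀ {p q} → Chain p [] q
    _∷_ : ∀ {p x xs q} → Between x p (headOr xs q) → Chain x xs q → Chain p (x ∷ xs) q

  join : ∀ {p xs c ys q} → Chain p xs c → Between c (lastOr p xs) (headOr ys q) →
    Chain c ys q → Chain p (xs ++ c ∷ ys) q
  join []                        c-between right = c-between ∷ right
  join {xs = x ∷ xs} (x-between ∷ left) c-between right =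
    subst (Between x _) (sym (headOr-++ xs)) x-between ∷ join left c-between right

  ends-adjacent : ∀ {p xs q y} → Chain p xs q → y ∈ₗ xs →
    Adj G p (headOr xs q) × Adj G q (lastOr p xs)
  ends-adjacent {xs = _ ∷ []}    (x-between ∷ _) _ =
    edge-sym G (Between.adj-p x-between) , edge-sym G (Between.adj-q x-between)
  ends-adjacent {xs = _ ∷ _ ∷ _} (x-between ∷ rest) _ =
    edge-sym G (Between.adj-p x-between) , proj₂ (ends-adjacent rest (here refl))

  end-neighbour : ∀ {p xs q y z} → Chain p xs q → y ∈ₗ xs → Adj G y z → z ∉ₗ xs →
    (z ≡ p × y ≡ headOr xs q) ⊎ (z ≡ q × y ≡ lastOr p xs)
  end-neighbour {xs = _ ∷ []} (y-between ∷ _) (here refl) e _ with Between.only y-between e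
  ... | inj₁ z≡p = inj₁ (z≡p , refl)
  ... | inj₂ z≡q = inj₂ (z≡q , refl)
  end-neighbour {xs = _ ∷ _ ∷ _} (y-between ∷ _) (here refl) e z∉ with Between.only y-between e
  ... | inj₁ z≡p  = inj₁ (z≡p , refl)
  ... | inj₂ refl = ⊥-elim (z∉ (there (here refl)))
  end-neighbour (_ ∷ rest) (there y∈) e z∉ with end-neighbour rest y∈ e (z∉ ∘ there)
  ... | inj₁ (refl , _) = ⊥-elim (z∉ (here refl))
  ... | inj₂ at-q       = inj₂ at-q

  splice : ∀ {p xs c ys q} → Chain p xs c → Chain c ys q →
    c ∉ₗ xs → c ∉ₗ ys → p ≢ c → c ≢ q →
    (∀ {y} → Adj G c y → y ∈ₗ xs ⊎ y ∈ₗ ys ⊎ (y ≡ p × xs ≡ []) ⊎ (y ≡ q × ys ≡ [])) →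
    Adj G c (lastOr p xs) → Adj G c (headOr ys q) → Chain p (xs ++ c ∷ ys) q
  splice {p} {xs} {c} {ys} {q} left right c∉xs c∉ys p≢c c≢q neighbours adj-last adj-head =
    join left (record { only = only ; adj-p = adj-last ; adj-q = adj-head }) right
    where
    only : ∀ {y} → Adj G c y → y ≡ lastOr p xs ⊎ y ≡ headOr ys q
    only e with neighbours e
    ... | inj₂ (inj₂ (inj₁ (refl , refl))) = inj₁ refl
    ... | inj₂ (inj₂ (inj₂ (refl , refl))) = inj₂ refl
    ... | inj₁ y∈xs with end-neighbour left y∈xs (edge-sym G e) c∉xs
    ...   | inj₁ (c≡p , _)    = ⊥-elim (p≢c (sym c≡p))
    ...   | inj₂ (_ , y≡last) = inj₁ y≡last
    only e | inj₂ (inj₁ y∈ys) with end-neighbour right y∈ys (edge-sym G e) c∉ys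
    ...   | inj₁ (_ , y≡head) = inj₂ y≡head
    ...   | inj₂ (c≡q , _)    = ⊥-elim (c≢q c≡q)

  close : ∀ {a L y₀} → Chain a L a → a ∉ₗ L → (∀ {y} → Adj G a y → y ∈ₗ L) → y₀ ∈ₗ L →
    Chain (lastOr a L) (a ∷ L) a
  close {a} {L} chain a∉L neighbours y₀∈L =
    record { only = only ; adj-p = proj₂ ends ; adj-q = proj₁ ends } ∷ chain
    where
    ends = ends-adjacent chain y₀∈L
    only : ∀ {y} → Adj G a y → y ≡ lastOr a L ⊎ y ≡ headOr L a
    only e with end-neighbour chain (neighbours e) (edge-sym G e) a∉L
    ... | inj₁ (_ , y≡head) = inj₂ y≡head
    ... | inj₂ (_ , y≡last) = inj₁ y≡last

  record Traversal (a b : Fin n) (W : Subset n) : Set where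
    field
      route    : List (Fin n)
      chain    : Chain a route b
      unique   : Unique route
      complete : ∀ {y} → y ∈ W → y ∈ₗ route
      sound    : ∀ {y} → y ∈ₗ route → y ∈ W

  traversal-ends : ∀ {p q W} (P : Traversal p q W) → ((∀ {y} → y ∉ W) → Adj G p q) →
    Adj G p (headOr (Traversal.route P) q) × Adj G q (lastOr p (Traversal.route P))
  traversal-ends P adjacent-if-empty
    with Traversal.route P | Traversal.chain P | Traversal.complete P
  ... | []    | _     | complete = adjacent , edge-sym G adjacent
    where adjacent = adjacent-if-empty (∉[] ∘ complete)
  ... | _ ∷ _ | chain | _        = ends-adjacent chain (here refl)

  before : Fin n → (L : List (Fin n)) → Fin (length L) → Fin n
  before p (_ ∷ _)  zero    = p
  before _ (x ∷ xs) (suc i) = before x xs i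

  after : Fin n → (L : List (Fin n)) → Fin (length L) → Fin n
  after q (_ ∷ xs) zero    = headOr xs q
  after q (_ ∷ xs) (suc i) = after q xs i

  chain-between : ∀ {p L q} → Chain p L q → ∀ i → Between (lookup L i) (before p L i) (after q L i)
  chain-between (x-between ∷ _) zero    = x-between
  chain-between (_ ∷ rest)      (suc i) = chain-between rest i

  before-spec : ∀ p L i → (toℕ i ≡ 0 × before p L i ≡ p) ⊎
    Σ (Fin (length L)) λ j → suc (toℕ j) ≡ toℕ i × before p L i ≡ lookup L j
  before-spec p (_ ∷ _)  zero    = inj₁ (refl , refl)
  before-spec _ (x ∷ xs) (suc i) with before-spec x xs i
  ... | inj₁ (i≡0 , before≡x)  = inj₂ (zero , cong suc (sym i≡0) , before≡x)
  ... | inj₂ (j , j+1≡i , eq)  = inj₂ (suc j , cong suc j+1≡i , eq)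

  after-spec : ∀ q L i → (suc (toℕ i) ≡ length L × after q L i ≡ q) ⊎
    Σ (Fin (length L)) λ j → toℕ j ≡ suc (toℕ i) × after q L i ≡ lookup L j
  after-spec q (_ ∷ [])     zero    = inj₁ (refl , refl)
  after-spec q (_ ∷ _ ∷ _)  zero    = inj₂ (suc zero , refl , refl)
  after-spec q (_ ∷ xs)     (suc i) with after-spec q xs i
  ... | inj₁ (i+1≡m , after≡q) = inj₁ (cong suc i+1≡m , after≡q)
  ... | inj₂ (j , j≡i+1 , eq)  = inj₂ (suc j , cong suc j≡i+1 , eq)

  last-position : ∀ (x : Fin n) xs →
    Σ (Fin (length (x ∷ xs))) λ j → suc (toℕ j) ≡ length (x ∷ xs) × lookup (x ∷ xs) j ≡ lastOr x xs
  last-position x []       = zero , refl , refl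
  last-position x (y ∷ ys) with last-position y ys
  ... | j , j+1≡m , eq = suc j , cong suc j+1≡m , eq

  after-cyclic : ∀ x rest i → Σ (Fin (length (x ∷ rest))) λ j →
    Succ i j × after x (x ∷ rest) i ≡ lookup (x ∷ rest) j
  after-cyclic x rest i with after-spec x (x ∷ rest) i
  ... | inj₁ (i+1≡m , after≡x) = zero , inj₂ (refl , i+1≡m) , after≡x
  ... | inj₂ (j , j≡i+1 , eq)  = j , inj₁ j≡i+1 , eq

  before-cyclic : ∀ x rest i → Σ (Fin (length (x ∷ rest))) λ j →
    Succ j i × before (lastOr x rest) (x ∷ rest) i ≡ lookup (x ∷ rest) j
  before-cyclic x rest i with before-spec (lastOr x rest) (x ∷ rest) i
  ... | inj₂ (j , j+1≡i , eq)   = j , inj₁ (sym j+1≡i) , eq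
  ... | inj₁ (i≡0 , before≡last) with last-position x rest
  ...   | j , j+1≡m , lookup≡last = j , inj₂ (i≡0 , j+1≡m) , trans before≡last (sym lookup≡last)

  ordering⇒cycle : ∀ {m} → m ≡ n → (π : Permutation m n) →
    (∀ i j → Adj G (π ⟨$⟩ʳ i) (π ⟨$⟩ʳ j) ⇔ (Succ i j ⊎ Succ j i)) → 3 ≤ n → IsCycle G
  ordering⇒cycle refl π adjacency 3≤n = 3≤n , π , λ i j → succ⇔cycleAdj ⇔-∘ adjacency i j
    where
    succ⇔cycleAdj : ∀ {i j : Fin n} → (Succ i j ⊎ Succ j i) ⇔ CycleAdj G i j
    succ⇔cycleAdj = mk⇔
      [ [ inj₁ , inj₂ ∘ inj₂ ∘ inj₂ ] , [ inj₂ ∘ inj₁ , inj₂ ∘ inj₂ ∘ inj₁ ] ]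
      [ inj₁ ∘ inj₁ , [ inj₂ ∘ inj₁ , [ inj₂ ∘ inj₂ , inj₁ ∘ inj₂ ] ] ]

  -- A duplicate-free cyclic chain through all vertices makes G a cycle:
  -- listing the vertices in chain order, adjacency is cyclic succession.
  cyclic-chain⇒cycle : ∀ {x rest} → Chain (lastOr x rest) (x ∷ rest) x → Unique (x ∷ rest) →
    (∀ y → y ∈ₗ x ∷ rest) → 3 ≤ n → IsCycle G
  cyclic-chain⇒cycle {x} {rest} chain unique everything =
    ordering⇒cycle (↔⇒≡ π) π adjacency
    where
    L = x ∷ rest
    position : Fin n → Fin (length L)
    position y = Any.index (everything y)
    π : Permutation (length L) n
    π = mk↔ₛ′ (lookup L) position (λ y → sym (lookup-index (everything y)))
               (λ i → lookup-injective unique _ i (sym (lookup-index (everything (lookup L i)))))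
    adjacency : ∀ i j → Adj G (lookup L i) (lookup L j) ⇔ (Succ i j ⊎ Succ j i)
    adjacency i j = mk⇔ to from
      where
      open Between (chain-between chain i)
      to : Adj G (lookup L i) (lookup L j) → Succ i j ⊎ Succ j i
      to e with only e | before-cyclic x rest i | after-cyclic x rest i
      ... | inj₁ j-before | k , k→i , before≡k | _ =
        inj₂ (subst (λ k → Succ k i)
                    (lookup-injective unique k j (trans (sym before≡k) (sym j-before))) k→i)
      ... | inj₂ j-after | _ | k , i→k , after≡k =
        inj₁ (subst (Succ i) (lookup-injective unique k j (trans (sym after≡k) (sym j-after))) i→k)
      from : Succ i j ⊎ Succ j i → Adj G (lookup L i) (lookup L j)
      from (inj₁ i→j) with after-cyclic x rest i
      ... | k , i→k , after≡k =
        subst (λ k → Adj G (lookup L i) (lookup L k)) (succ-functional i→k i→j)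
              (subst (Adj G _) after≡k adj-q)
      from (inj₂ j→i) with before-cyclic x rest i
      ... | k , k→i , before≡k =
        subst (λ k → Adj G (lookup L i) (lookup L k)) (succ-injective k→i j→i)
              (subst (Adj G _) before≡k adj-p)

  module _ (biconnected : Biconnected G) where

    avoiding : ∀ x {u v} → u ≢ x → v ≢ x → WalkIn G (∁ ⁅ x ⁆) u v
    avoiding x {u} {v} u≢x v≢x with connected? (∁ ⁅ x ⁆) u v
    ... | yes u~v = u~v
    ... | no ¬u~v = ⊥-elim (proj₂ biconnected ⁅ x ⁆ (s≤s (ℕₚ.≤-reflexive (∣⁅x⁆∣≡1 x)))
                      (u , v , u≢x ∘ x∈⁅y⁆⇒x≡y x , v≢x ∘ x∈⁅y⁆⇒x≡y x , ¬u~v))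

    record Attachment (W : Subset n) (w₀ a : Fin n) : Set where
      field
        foot     : Fin n
        foot∈W   : foot ∈ W
        foot-adj : Adj G foot a
        route    : WalkIn G W w₀ foot

    -- Each end of a nonempty fragment is attached to it: follow a walk from
    -- w₀ to a avoiding b until it first leaves W; it can only leave to a.
    attachment : ∀ {a b W w₀} → Fragment a b W → w₀ ∈ W → Attachment W w₀ a
    attachment {a} {b} {W} {w₀} F w₀∈W =
      attach (exit w₀∈W a∉W (avoiding b (λ { refl → b∉W w₀∈W }) a≢b))
      where
      open Fragment F
      attach : Exit (∁ ⁅ b ⁆) W w₀ → Attachment W w₀ a
      attach ex with neighbour (proj₂ (x∈p∩q⁻ _ W (end∈ (Exit.route ex)))) (Exit.crossing ex)
      ... | inj₁ out∈W       = ⊥-elim (Exit.outside-K ex out∈W)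
      ... | inj₂ (inj₂ refl) = ⊥-elim (x∈∁p⇒x∉p (Exit.outside-∈X ex) (x∈⁅x⁆ b))
      ... | inj₂ (inj₁ refl) = record
        { foot∈W = proj₂ (x∈p∩q⁻ _ W (end∈ (Exit.route ex)))
        ; foot-adj = Exit.crossing ex
        ; route = widen (p∩q⊆q _ W) (Exit.route ex) }

    through : ∀ {a b W w₀} → Fragment a b W → w₀ ∈ W → WalkIn G (W ∪ pair a b) a b
    through {a} {b} {W} F w₀∈W =
      step (x∈p∪q⁺ (inj₂ a∈pair)) (edge-sym G (Attachment.foot-adj at-a))
        (reverseʷ (widen W⊆ (Attachment.route at-a)) ++ʷ
         snocʷ (widen W⊆ (Attachment.route at-b)) (Attachment.foot-adj at-b) (x∈p∪q⁺ (inj₂ b∈pair)))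
      where
      at-a = attachment F w₀∈W
      at-b = attachment (fragment-swap F) w₀∈W
      W⊆ : W ⊆ W ∪ pair a b
      W⊆ w∈W = x∈p∪q⁺ (inj₁ w∈W)

    separator-meets : ∀ {a b W w₀ T} → Fragment a b W → w₀ ∈ W → Separates T a b →
      ∃ λ c → c ∈ T × c ∈ W
    separator-meets {a} {b} {W} {T = T} F w₀∈W (a∉T , b∉T , ¬a~b)
      with any? (λ c → (c ∈? T) ×-dec (c ∈? W))
    ... | yes meet = meet
    ... | no  miss = ⊥-elim (¬a~b (widen avoids-T (through F w₀∈W)))
      where
      avoids-T : W ∪ pair a b ⊆ ∁ T
      avoids-T {y} y∈ with x∈p∪q⁻ W (pair a b) y∈
      ... | inj₁ y∈W  = x∉p⇒x∈∁p λ y∈T → miss (y , y∈T , y∈W)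
      ... | inj₂ y∈ab = x∉p⇒x∈∁p ([ (λ { refl → a∉T }) , (λ { refl → b∉T }) ] (∈-pair⁻ y∈ab))

    -- If {a, b} splits a 2-cutset T = {u, v}, then T separates a from b.  Otherwise
    -- a component K of G - T missing a would carry a walk from u to v through
    -- K, avoiding a and b.
    splits-back : ∀ {T a b} → Cutset₂ G T → Splits G (pair a b) T → Separates T a b
    splits-back {T} {a} {b} (∣T∣≡2 , x , y , x∉T , y∉T , ¬x~y) ab-splits-T
      with two-element T ∣T∣≡2
    ... | u , v , u≢v , refl = ∉uv a∈pair , ∉uv b∈pair , ¬a~b
      where
      uv-separated : Separates (pair a b) u v
      uv-separated = splits-pair ab-splits-T
      u∉ab = proj₁ uv-separated
      v∉ab = proj₁ (proj₂ uv-separated)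
      ∉uv : ∀ {z} → z ∈ pair a b → z ∉ pair u v
      ∉uv z∈ab z∈uv = [ (λ { refl → u∉ab z∈ab }) , (λ { refl → v∉ab z∈ab }) ] (∈-pair⁻ z∈uv)
      ¬a~b : ¬ WalkIn G (∁ (pair u v)) a b
      ¬a~b a~b = proj₂ (proj₂ uv-separated) (widen avoids-ab (through K-fragment (source K)))
        where
        -- one of x and y is not joined to a
        far : Σ (Fin n) λ s → s ∉ pair u v × ¬ WalkIn G (∁ (pair u v)) s a
        far with connected? (∁ (pair u v)) x a
        ... | no  ¬x~a = x , x∉T , ¬x~a
        ... | yes x~a  = y , y∉T , λ y~a → ¬x~y (x~a ++ʷ reverseʷ y~a)
        s = proj₁ far
        s∉uv = proj₁ (proj₂ far)
        ¬s~a = proj₂ (proj₂ far)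
        K = component (∁ (pair u v)) s (x∉p⇒x∈∁p s∉uv)
        K-fragment = component-fragment u≢v s∉uv (∉uv a∈pair) ¬s~a
        avoids-ab : members K ∪ pair u v ⊆ ∁ (pair a b)
        avoids-ab {z} z∈ with x∈p∪q⁻ (members K) (pair u v) z∈
        ... | inj₂ z∈uv = x∉p⇒x∈∁p λ z∈ab → ∉uv z∈ab z∈uv
        ... | inj₁ z∈K  = x∉p⇒x∈∁p (∉-pair z≢a z≢b)
          where
          z≢a : z ≢ a
          z≢a refl = ¬s~a (reachable K z∈K)
          z≢b : z ≢ b
          z≢b refl = ¬s~a (reachable K z∈K ++ʷ reverseʷ a~b)

    module _ (no-single : ∀ S → ¬ Single G S) where

      crossing-separator : ∀ {a b} → Cutset₂ G (pair a b) →
        Σ (Subset n) λ T → ∣ T ∣ ≡ 2 × Separates T a b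
      crossing-separator {a} {b} ab-cut with crossing-cutset ab-cut (no-single (pair a b))
      ... | T , T-cut , inj₁ ab-splits-T = T , proj₁ T-cut , splits-back T-cut ab-splits-T
      ... | T , T-cut , inj₂ T-splits-ab = T , proj₁ T-cut , splits-pair T-splits-ab

      ends-nonadjacent : ∀ {a b W w} → Fragment a b W → w ∈ W → ¬ Adj G a b
      ends-nonadjacent F w∈W e with crossing-separator (fragment-cutset F w∈W)
      ... | _ , _ , a∉T , b∉T , ¬a~b = ¬a~b (edgeʷ (x∉p⇒x∈∁p a∉T) e (x∉p⇒x∈∁p b∉T))

      adjacent-ends : ∀ {a b W} → Fragment a b W → (P : Traversal a b W) → Adj G a b →
        Traversal.route P ≡ []
      adjacent-ends F P e with Traversal.route P | Traversal.sound P
      ... | []    | _     = refl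
      ... | _ ∷ _ | sound = ⊥-elim (ends-nonadjacent F (sound (here refl)) e)

      record Split (a b : Fin n) (W : Subset n) : Set where
        field
          T         : Subset n
          separates : Separates T a b
          c         : Fin n
          c∈T       : c ∈ T
          c∈W       : c ∈ W
          off-T     : ∀ {y} → y ∈ W → y ≢ c → y ∉ T

      split-swap : ∀ {a b W} → Split a b W → Split b a W
      split-swap S = record
        { T = T ; separates = separates-sym separates
        ; c = c ; c∈T = c∈T ; c∈W = c∈W ; off-T = off-T }
        where open Split S

      -- A 2-cutset separating a from b meets both W and its complementary
      -- fragment, hence each of them exactly once.
      split : ∀ {a b W w₀} → Fragment a b W → w₀ ∈ W → Split a b W
      split {a} {b} {W} F w₀∈W with crossing-separator (fragment-cutset F w₀∈W)
      ... | T , ∣T∣≡2 , separates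
        with separator-meets F w₀∈W separates
           | separator-meets (complement F w₀∈W) outer∈Z (separates-sym separates)
        where
        open Fragment F
        outer∈Z = ∈∁∪ outer∉W outer∉ab
      ... | c , c∈T , c∈W | d , d∈T , d∈Z = record
        { T = T ; separates = separates ; c = c ; c∈T = c∈T ; c∈W = c∈W ; off-T = off-T }
        where
        d∉W : d ∉ W
        d∉W d∈W = x∈∁p⇒x∉p d∈Z (x∈p∪q⁺ (inj₁ d∈W))
        off-T : ∀ {y} → y ∈ W → y ≢ c → y ∉ T
        off-T y∈W y≢c y∈T
          with ∈-pair⁻ (⊆-pair (λ { refl → d∉W c∈W }) c∈T d∈T (ℕₚ.≤-reflexive ∣T∣≡2) y∈T)
        ... | inj₁ y≡c  = y≢c y≡c
        ... | inj₂ refl = d∉W y∈W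

      module Near {a b W} (F : Fragment a b W) (S : Split a b W) where
        open Fragment F
        open Split S

        A : Component (∁ T) a
        A = component (∁ T) a (x∉p⇒x∈∁p (proj₁ separates))

        near : Subset n
        near = W ∩ members A

        near⊆W : near ⊆ W
        near⊆W y∈ = proj₁ (x∈p∩q⁻ W (members A) y∈)

        near⊆A : near ⊆ members A
        near⊆A y∈ = proj₂ (x∈p∩q⁻ W (members A) y∈)

        c∉near : c ∉ near
        c∉near c∈ = x∈∁p⇒x∉p (end∈ (reachable A (near⊆A c∈))) c∈T

        near-smaller : ∣ near ∣ < ∣ W ∣
        near-smaller = p⊂q⇒∣p∣<∣q∣ (near⊆W , c , c∈W , c∉near)

        -- Its neighbours in W other than c avoid T and hence join the near
        -- side; b cannot be a neighbour, since T separates a from b.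
        near-fragment : Fragment a c near
        near-fragment = record
          { a≢b = λ { refl → a∉W c∈W } ; a∉W = a∉W ∘ near⊆W ; b∉W = c∉near
          ; W-closed = near-closed
          ; outer = b ; outer∉W = b∉W ∘ near⊆W
          ; outer∉ab = ∉-pair (a≢b ∘ sym) (λ { refl → b∉W c∈W }) }
          where
          near-closed : Closed (∁ (pair a c)) near
          near-closed {w' = y} q∈ y∉ac e with neighbour (near⊆W q∈) e
          ... | inj₂ (inj₁ refl) = ⊥-elim (x∈∁p⇒x∉p y∉ac a∈pair)
          ... | inj₂ (inj₂ refl) =
            ⊥-elim (proj₂ (proj₂ separates) (reachable A (closed A (near⊆A q∈) (x∉p⇒x∈∁p b∉T) e)))
            where b∉T = proj₁ (proj₂ separates)
          ... | inj₁ y∈W = x∈p∩q⁺ (y∈W , closed A (near⊆A q∈) (x∉p⇒x∈∁p (off-T y∈W y≢c)) e)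
            where
            y≢c : y ≢ c
            y≢c refl = x∈∁p⇒x∉p y∉ac b∈pair

        -- If the near side is empty, c is adjacent to a: the foot of a's
        -- attachment lies in W, and any foot other than c is on the near side.
        near-attached : (∀ {y} → y ∉ near) → Adj G c a
        near-attached empty = from-attachment (attachment F c∈W)
          where
          from-attachment : Attachment W c a → Adj G c a
          from-attachment at with Attachment.foot at ≟ c
          ... | yes foot≡c = subst (λ x → Adj G x a) foot≡c (Attachment.foot-adj at)
          ... | no  foot≢c = ⊥-elim (empty (x∈p∩q⁺ (foot∈W , foot∈A)))
            where
            open Attachment at
            foot∈A = closed A (source A) (x∉p⇒x∈∁p (off-T foot∈W foot≢c)) (edge-sym G foot-adj)

      module Halves {a b W} (F : Fragment a b W) (S : Split a b W) where
        open Fragment F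
        open Split S
        module L = Near F S
        module R = Near (fragment-swap F) (split-swap S)

        U : Subset n
        U = members L.A ∪ members R.A

        -- Every vertex y ≢ c of W is joined to a or b in G - T: a walk from y
        -- to a avoiding c would leave W - U along an edge into U, but U is
        -- closed in G - T and that edge starts outside T.
        joined : ∀ {y} → y ∈ W → y ≢ c → y ∈ U
        joined {y} y∈W y≢c with y ∈? U
        ... | yes y∈U = y∈U
        ... | no  y∉U = ⊥-elim (escape (exit y∈K (a∉W ∘ proj₁ ∘ x∈p∩q⁻ W (∁ U))
                                          (avoiding c y≢c (λ { refl → a∉W c∈W }))))
          where
          K = W ∩ ∁ U
          y∈K = x∈p∩q⁺ (y∈W , x∉p⇒x∈∁p y∉U)
          escape : Exit (∁ ⁅ c ⁆) K y → ⊥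
          escape ex =
            x∈∁p⇒x∉p h∉U (closed-∪ (closed L.A) (closed R.A) h'∈U h∉T (edge-sym G crossing))
            where
            open Exit ex
            h∈ = x∈p∩q⁻ (∁ ⁅ c ⁆) K (end∈ route)
            h∈W = proj₁ (x∈p∩q⁻ W (∁ U) (proj₂ h∈))
            h∉U = proj₂ (x∈p∩q⁻ W (∁ U) (proj₂ h∈))
            h∉T = x∉p⇒x∈∁p (off-T h∈W λ { refl → x∈∁p⇒x∉p (proj₁ h∈) (x∈⁅x⁆ c) })
            h'∈U : first-outside ∈ U
            h'∈U with neighbour h∈W crossing
            ... | inj₂ (inj₁ refl) = x∈p∪q⁺ (inj₁ (source L.A))
            ... | inj₂ (inj₂ refl) = x∈p∪q⁺ (inj₂ (source R.A))
            ... | inj₁ h'∈W with first-outside ∈? U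
            ...   | yes h'∈U = h'∈U
            ...   | no  h'∉U = ⊥-elim (outside-K (x∈p∩q⁺ (h'∈W , x∉p⇒x∈∁p h'∉U)))

        cover : ∀ {y} → y ∈ W → y ≢ c → y ∈ L.near ⊎ y ∈ R.near
        cover y∈W y≢c with x∈p∪q⁻ (members L.A) (members R.A) (joined y∈W y≢c)
        ... | inj₁ y∈A = inj₁ (x∈p∩q⁺ (y∈W , y∈A))
        ... | inj₂ y∈B = inj₂ (x∈p∩q⁺ (y∈W , y∈B))

        disjoint : ∀ {y} → y ∈ L.near → y ∈ R.near → ⊥
        disjoint y∈L y∈R = proj₂ (proj₂ separates)
          (reachable L.A (L.near⊆A y∈L) ++ʷ reverseʷ (reachable R.A (R.near⊆A y∈R)))

        module Combine (P : Traversal a c L.near) (Q : Traversal c b R.near) where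
          module P = Traversal P
          module Q = Traversal Q

          c∉P : c ∉ₗ P.route
          c∉P = L.c∉near ∘ P.sound

          c∉Q : c ∉ₗ Q.route
          c∉Q = R.c∉near ∘ Q.sound

          -- A neighbour of c is in W, hence on one side, or it is an end,
          -- whose side is then empty.
          neighbours : ∀ {y} → Adj G c y →
            y ∈ₗ P.route ⊎ y ∈ₗ Q.route ⊎ (y ≡ a × P.route ≡ []) ⊎ (y ≡ b × Q.route ≡ [])
          neighbours {y} e with neighbour c∈W e
          ... | inj₂ (inj₁ refl) =
            inj₂ (inj₂ (inj₁ (refl , adjacent-ends L.near-fragment P (edge-sym G e))))
          ... | inj₂ (inj₂ refl) =
            inj₂ (inj₂ (inj₂ (refl , adjacent-ends (fragment-swap R.near-fragment) Q e)))
          ... | inj₁ y∈W with cover y∈W (λ { refl → irrefl G e })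
          ...   | inj₁ y∈L = inj₁ (P.complete y∈L)
          ...   | inj₂ y∈R = inj₂ (inj₁ (Q.complete y∈R))

          complete : ∀ {y} → y ∈ W → y ∈ₗ P.route ++ c ∷ Q.route
          complete {y} y∈W with y ≟ c
          ... | yes refl = ∈-++⁺ʳ P.route (here refl)
          ... | no  y≢c with cover y∈W y≢c
          ...   | inj₁ y∈L = ∈-++⁺ˡ (P.complete y∈L)
          ...   | inj₂ y∈R = ∈-++⁺ʳ P.route (there (Q.complete y∈R))

          sound : ∀ {y} → y ∈ₗ P.route ++ c ∷ Q.route → y ∈ W
          sound y∈ with ∈-++⁻ P.route y∈
          ... | inj₁ y∈P         = L.near⊆W (P.sound y∈P)
          ... | inj₂ (here refl) = c∈W
          ... | inj₂ (there y∈Q) = R.near⊆W (Q.sound y∈Q)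

          traversal : Traversal a b W
          traversal = record
            { route    = P.route ++ c ∷ Q.route
            ; chain    = splice P.chain Q.chain c∉P c∉Q
                           (λ { refl → a∉W c∈W }) (λ { refl → b∉W c∈W }) neighbours
                           (proj₂ (traversal-ends P (edge-sym G ∘ L.near-attached)))
                           (proj₁ (traversal-ends Q R.near-attached))
            ; unique   = unique-splice P.unique Q.unique c∉P c∉Q
                           λ y∈P y∈Q → disjoint (P.sound y∈P) (Q.sound y∈Q)
            ; complete = complete
            ; sound    = sound }

      traverse : ∀ k {a b W} → ∣ W ∣ < k → Fragment a b W → Traversal a b W
      traverse zero    () _
      traverse (suc k) {W = W} ∣W∣<k F with any? (_∈? W)
      ... | no empty = record
        { route = [] ; chain = [] ; unique = []
        ; complete = λ y∈W → ⊥-elim (empty (_ , y∈W)) ; sound = λ () }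
      ... | yes (w₀ , w₀∈W) =
        Combine.traversal (traverse k (shrink L.near-smaller) L.near-fragment)
                          (traverse k (shrink R.near-smaller) (fragment-swap R.near-fragment))
        where
        open Halves F (split F w₀∈W)
        shrink : ∀ {m} → m < ∣ W ∣ → m < k
        shrink m<∣W∣ = ℕₚ.<-≤-trans m<∣W∣ (ℕₚ.≤-pred ∣W∣<k)

      -- If {a, b} separates u from v, G is a cycle: traverse the component W
      -- of u in G - {a, b} from a to b and the complementary fragment Z from
      -- b to a, splice the two chains at b and close them up at a.
      module Hamiltonian {a b u v} (a≢b : a ≢ b) (u∉ab : u ∉ pair a b) (v∉ab : v ∉ pair a b)
                         (¬u~v : ¬ WalkIn G (∁ (pair a b)) u v) where

        W : Subset n
        W = members (component (∁ (pair a b)) u (x∉p⇒x∈∁p u∉ab))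

        Z : Subset n
        Z = ∁ (W ∪ pair a b)

        F : Fragment a b W
        F = component-fragment a≢b u∉ab v∉ab ¬u~v

        u∈W : u ∈ W
        u∈W = source (component (∁ (pair a b)) u (x∉p⇒x∈∁p u∉ab))

        v∈Z : v ∈ Z
        v∈Z = ∈∁∪ (Fragment.outer∉W F) v∉ab

        Fᶜ : Fragment b a Z
        Fᶜ = complement F u∈W

        through-W : Traversal a b W
        through-W = traverse (suc ∣ W ∣) (ℕₚ.n<1+n _) F

        through-Z : Traversal b a Z
        through-Z = traverse (suc ∣ Z ∣) (ℕₚ.n<1+n _) Fᶜ

        module P = Traversal through-W
        module Q = Traversal through-Z

        L : List (Fin n)
        L = P.route ++ b ∷ Q.route

        locate : ∀ y → y ∈ W ⊎ y ∈ Z ⊎ y ≡ a ⊎ y ≡ b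
        locate y with y ∈? W | y ∈? pair a b
        ... | yes y∈W | _         = inj₁ y∈W
        ... | no  _   | yes y∈ab  = inj₂ (inj₂ (∈-pair⁻ y∈ab))
        ... | no  y∉W | no  y∉ab  = inj₂ (inj₁ (∈∁∪ y∉W y∉ab))

        everywhere : ∀ y → y ∈ₗ a ∷ L
        everywhere y with locate y
        ... | inj₁ y∈W                = there (∈-++⁺ˡ (P.complete y∈W))
        ... | inj₂ (inj₁ y∈Z)         = there (∈-++⁺ʳ P.route (there (Q.complete y∈Z)))
        ... | inj₂ (inj₂ (inj₁ refl)) = here refl
        ... | inj₂ (inj₂ (inj₂ refl)) = there (∈-++⁺ʳ P.route (here refl))

        b∉P : b ∉ₗ P.route
        b∉P = Fragment.b∉W F ∘ P.sound

        b∉Q : b ∉ₗ Q.route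
        b∉Q = Fragment.a∉W Fᶜ ∘ Q.sound

        a∉L : a ∉ₗ L
        a∉L a∈L with ∈-++⁻ P.route a∈L
        ... | inj₁ a∈P         = Fragment.a∉W F (P.sound a∈P)
        ... | inj₂ (here a≡b)  = a≢b a≡b
        ... | inj₂ (there a∈Q) = Fragment.b∉W Fᶜ (Q.sound a∈Q)

        unique : Unique (a ∷ L)
        unique = ¬Any⇒All¬ L a∉L ∷ unique-splice P.unique Q.unique b∉P b∉Q disjoint
          where
          disjoint : ∀ {y} → y ∈ₗ P.route → y ∈ₗ Q.route → ⊥
          disjoint y∈P y∈Q = x∈∁p⇒x∉p (Q.sound y∈Q) (x∈p∪q⁺ (inj₁ (P.sound y∈P)))

        -- b is not adjacent to a, so its neighbours lie in W or Z.
        b-neighbours : ∀ {y} → Adj G b y →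
          y ∈ₗ P.route ⊎ y ∈ₗ Q.route ⊎ (y ≡ a × P.route ≡ []) ⊎ (y ≡ a × Q.route ≡ [])
        b-neighbours {y} e with locate y
        ... | inj₁ y∈W                = inj₁ (P.complete y∈W)
        ... | inj₂ (inj₁ y∈Z)         = inj₂ (inj₁ (Q.complete y∈Z))
        ... | inj₂ (inj₂ (inj₁ refl)) = ⊥-elim (ends-nonadjacent F u∈W (edge-sym G e))
        ... | inj₂ (inj₂ (inj₂ refl)) = ⊥-elim (irrefl G e)

        a-neighbours : ∀ {y} → Adj G a y → y ∈ₗ L
        a-neighbours {y} e with everywhere y
        ... | here refl = ⊥-elim (irrefl G e)
        ... | there y∈L = y∈L

        ab-chain : Chain a L a
        ab-chain = splice P.chain Q.chain b∉P b∉Q a≢b (a≢b ∘ sym) b-neighbours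
          (proj₂ (traversal-ends through-W (λ empty → ⊥-elim (empty u∈W))))
          (proj₁ (traversal-ends through-Z (λ empty → ⊥-elim (empty v∈Z))))

        cycle : IsCycle G
        cycle = cyclic-chain⇒cycle (close ab-chain a∉L a-neighbours (∈-++⁺ʳ P.route (here refl)))
          unique everywhere (proj₁ biconnected)

      cutset₂⇒cycle : ∀ {R} → Cutset₂ G R → IsCycle G
      cutset₂⇒cycle {R} (∣R∣≡2 , u , v , u∉R , v∉R , ¬u~v) with two-element R ∣R∣≡2
      ... | a , b , a≢b , refl = Hamiltonian.cycle a≢b u∉R v∉R ¬u~v

exhaust-Fin3 : ∀ {x y z : Fin 3} → x ≢ y → x ≢ z → y ≢ z → ∀ w → w ≡ x ⊎ w ≡ y ⊎ w ≡ z
exhaust-Fin3 {x} {y} {z} x≢y x≢z y≢z w with x∈p∪q⁻ (pair x y) ⁅ z ⁆ w∈xyz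
  where
  ∣xyz∣≡3 : ∣ pair x y ∪ ⁅ z ⁆ ∣ ≡ 3
  ∣xyz∣≡3 = trans (∣p∪⁅x⁆∣≡1+∣p∣ (pair x y) z (∉-pair (x≢z ∘ sym) (y≢z ∘ sym)))
                  (cong suc (∣pair∣≡2 x≢y))
  w∈xyz = subst (w ∈_) (sym (∣p∣≡n⇒p≡⊤ ∣xyz∣≡3)) ∈⊤
... | inj₁ w∈xy = [ inj₁ , inj₂ ∘ inj₁ ] (∈-pair⁻ w∈xy)
... | inj₂ w∈z  = inj₂ (inj₂ (x∈⁅y⁆⇒x≡y z w∈z))

fresh : ∀ {n} (p : Subset n) → ∣ p ∣ < n → ∃ λ k → k ∉ p
fresh {n} p ∣p∣<n with any? (λ k → ¬? (k ∈? p))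
... | yes outside-p = outside-p
... | no  none      = contradiction (subst (_≤ ∣ p ∣) (∣⊤∣≡n n) (p⊆q⇒∣p∣≤∣q∣ ⊤⊆p)) (ℕₚ.<⇒≱ ∣p∣<n)
  where
  ⊤⊆p : ⊤ ⊆ p
  ⊤⊆p {k} _ with k ∈? p
  ... | yes k∈p = k∈p
  ... | no  k∉p = ⊥-elim (none (k , k∉p))

module Triangle (G : Graph 3) (biconnected : Biconnected G) where

  -- Distinct vertices i, j are adjacent: a walk between them avoiding the
  -- third vertex k must step from i directly to j.
  adjacent : ∀ {i j} → i ≢ j → Adj G i j
  adjacent {i} {j} i≢j with fresh (pair i j) (ℕₚ.≤-reflexive (cong suc (∣pair∣≡2 i≢j)))
  ... | k , k∉ij =
    step-to-j (exit G (x∈⁅x⁆ i) (i≢j ∘ sym ∘ x∈⁅y⁆⇒x≡y i) (avoiding G biconnected k i≢k j≢k))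
    where
    i≢k : i ≢ k
    i≢k refl = k∉ij a∈pair
    j≢k : j ≢ k
    j≢k refl = k∉ij b∈pair
    step-to-j : Exit G (∁ ⁅ k ⁆) ⁅ i ⁆ i → Adj G i j
    step-to-j ex with exhaust-Fin3 i≢j i≢k j≢k first-outside
      where open Exit ex
    ... | inj₁ refl        = ⊥-elim (Exit.outside-K ex (x∈⁅x⁆ i))
    ... | inj₂ (inj₂ refl) = ⊥-elim (x∈∁p⇒x∉p (Exit.outside-∈X ex) (x∈⁅x⁆ k))
    ... | inj₂ (inj₁ refl) = subst (λ h → Adj G h j) h≡i (Exit.crossing ex)
      where h≡i = x∈⁅y⁆⇒x≡y i (proj₂ (x∈p∩q⁻ (∁ ⁅ k ⁆) ⁅ i ⁆ (end∈ G (Exit.route ex))))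

  between : ∀ {x p q} → x ≢ p → x ≢ q → p ≢ q → Between G x p q
  between {x} {p} {q} x≢p x≢q p≢q = record
    { only = only ; adj-p = adjacent x≢p ; adj-q = adjacent x≢q }
    where
    only : ∀ {y} → Adj G x y → y ≡ p ⊎ y ≡ q
    only {y} e with exhaust-Fin3 p≢q (x≢p ∘ sym) (x≢q ∘ sym) y
    ... | inj₁ y≡p          = inj₁ y≡p
    ... | inj₂ (inj₁ y≡q)   = inj₂ y≡q
    ... | inj₂ (inj₂ refl)  = ⊥-elim (irrefl G e)

  triangle : IsCycle G
  triangle = cyclic-chain⇒cycle G
    (between (λ ()) (λ ()) (λ ()) ∷ between (λ ()) (λ ()) (λ ()) ∷
     between (λ ()) (λ ()) (λ ()) ∷ [])
    (((λ ()) ∷ (λ ()) ∷ []) ∷ ((λ ()) ∷ []) ∷ [] ∷ [])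
    everything (s≤s (s≤s (s≤s z≤n)))
    where
    everything : ∀ y → y ∈ₗ zero ∷ suc zero ∷ suc (suc zero) ∷ []
    everything zero             = here refl
    everything (suc zero)       = there (here refl)
    everything (suc (suc zero)) = there (there (here refl))

at-most-three : ∀ {n} (G : Graph n) → Biconnected G → ¬ 3 < n → IsCycle G
at-most-three {suc (suc (suc zero))} G biconnected _ = Triangle.triangle G biconnected
at-most-three {suc (suc (suc (suc _)))} G _ 3≮n = ⊥-elim (3≮n (s≤s (s≤s (s≤s (s≤s z≤n)))))
at-most-three {0}             G (() , _) _
at-most-three {1}             G (s≤s () , _) _
at-most-three {2}             G (s≤s (s≤s ()) , _) _

theorem2 : {n : ℕ} (G : Graph n) → Biconnected G →
    (∀ (S : Subset n) → ¬ Single G S) →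
    Triconnected G ⊎ IsCycle G
theorem2 {n} G biconnected no-single with anySubset? (cutset₂? G)
... | yes (_ , R-cut) = inj₂ (cutset₂⇒cycle G biconnected no-single R-cut)
... | no no-2-cutset with 3 ℕ.<? n
...   | no  3≮n = inj₂ (at-most-three G biconnected 3≮n)
...   | yes 3<n = inj₁ (3<n , no-small-cutset)
  where
  no-small-cutset : ∀ R → suc ∣ R ∣ ≤ 3 → ¬ Cutset G R
  no-small-cutset R ∣R∣<3 R-cut with ∣ R ∣ ℕ.≟ 2
  ... | yes ∣R∣≡2 = no-2-cutset (R , ∣R∣≡2 , R-cut)
  ... | no  ∣R∣≢2 = proj₂ biconnected R (ℕₚ.≤∧≢⇒< (ℕₚ.≤-pred ∣R∣<3) ∣R∣≢2) R-cut
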